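{- Let $G$ be an undirected graph on $[p]$ and let $\mathcal{I}=(\emptyset,I_1,\dots,I_K)$ be a sequence of intervention targets with $I_k\subseteq[p]$. Then $\mathrm{CIM}_G^{\mathcal{I}}$ is a face of both $\mathrm{CIM}_p^{\mathcal{I}}$ and $\mathrm{CIM}_{p,K}$.
   Context: For a sequence $\mathcal{J}=(\emptyset,J_1,\dots,J_K)$ of subsets of $[p]$ and a DAG $\mathcal{G}$ on $[p]$, the $\mathcal{J}$-DAG $\mathcal{G}^{\mathcal{J}}$ is the DAG on $[p]\cup\{z_1,\dots,z_K\}$ with the edges of $\mathcal{G}$ together with $z_k\to i$ for all $i\in J_k$. For a DAG $\mathcal{D}$ on a finite set $V$ and $A\subseteq V$, $c_{\mathcal{D}}(A)=1$ if some $a\in A$ has every $b\in A\setminus\{a\}$ as a parent in $\mathcal{D}$, and $0$ otherwise. $\mathrm{CIM}_{p,K}=\mathrm{conv}\{c_{\mathcal{G}^{\mathcal{J}}}\}$ over all DAGs $\mathcal{G}$ on $[p]$ and all sequences $\mathcal{J}$; $\mathrm{CIM}_p^{\mathcal{I}}=\mathrm{conv}\{c_{\mathcal{G}^{\mathcal{I}}}:\mathcal{G}\text{ a DAG on }[p]\}$; $\mathrm{CIM}_G^{\mathcal{I}}=\mathrm{conv}\{c_{\mathcal{G}^{\mathcal{I}}}:\mathcal{G}\text{ a DAG on }[p]\text{ whose skeleton (underlying undirected graph) is }G\}$.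
   Formalization: The polytopes $\mathrm{CIM}_G^{\mathcal{I}}$, $\mathrm{CIM}_p^{\mathcal{I}}$ and $\mathrm{CIM}_{p,K}$ consist of points with rational coordinates, formed with rational convex weights, and faces are cut out by inequalities with rational coefficients and bounds. -}

module Defs where

open import Data.Nat using (ℕ; zero; suc) renaming (_+_ to _+ℕ_)
open import Data.Bool using (Bool; true; false; _∧_; _∨_; not; if_then_else_)
open import Data.Fin using (Fin; splitAt; _≟_)
open import Data.Fin.Subset using (Subset)
open import Data.Vec using (Vec; []; _∷_; lookup)
open import Data.List using (List; []; _∷_; map; _++_; foldr)
open import Data.Bool.ListAction using (any; all)
open import Data.List.Relation.Unary.All using (All)
open import Data.Sum using (_⊎_; inj₁; inj₂)
open import Data.Product using (Σ; _×_; _,_; ∃)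
open import Data.Empty using (⊥)
open import Relation.Nullary using (¬_)
open import Relation.Nullary.Decidable using (⌊_⌋)
open import Relation.Binary.PropositionalEquality using (_≡_)
open import Data.Rational using (ℚ; 0ℚ; 1ℚ; _+_; _*_; _≤_)

import Data.List as L

elems : (n : ℕ) → List (Fin n)
elems n = L.allFin n

allSubsets : (n : ℕ) → List (Subset n)
allSubsets zero    = [] ∷ []
allSubsets (suc n) = map (true ∷_) (allSubsets n) ++ map (false ∷_) (allSubsets n)

-- Directed graphs on Fin n: E i j = true means an edge i → j.
Digraph : ℕ → Set
Digraph n = Fin n → Fin n → Bool

data Path {n : ℕ} (E : Digraph n) : Fin n → Fin n → Set where
  edge : ∀ {i j} → E i j ≡ true → Path E i j
  step : ∀ {i j k} → E i j ≡ true → Path E j k → Path E i k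

IsDAG : {n : ℕ} → Digraph n → Set
IsDAG E = ∀ i → ¬ Path E i i

record SimpleGraph (p : ℕ) : Set where
  field
    adj   : Fin p → Fin p → Bool
    sym   : ∀ i j → adj i j ≡ adj j i
    irrefl : ∀ i → adj i i ≡ false

HasSkeleton : {p : ℕ} → Digraph p → SimpleGraph p → Set
HasSkeleton E G = ∀ i j → (E i j ∨ E j i) ≡ SimpleGraph.adj G i j

-- A sequence of targets (∅, J_1, …, J_K) is given by J : Fin K → Subset p
-- (the leading ∅ adds no node/edges).
Targets : ℕ → ℕ → Set
Targets p K = Fin K → Subset p

-- The J-DAG on [p] ∪ {z_1..z_K}, with vertex set Fin (p + K):
-- the first p vertices are [p], the last K are z_1..z_K.
jDAG : {p K : ℕ} → Digraph p → Targets p K → Digraph (p +ℕ K)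
jDAG {p} {K} E J u v with splitAt p u | splitAt p v
... | inj₁ i | inj₁ j = E i j
... | inj₂ k | inj₁ i = lookup (J k) i
... | _      | _      = false

-- Characteristic imset value c_D(A): 1 if some a ∈ A has every
-- b ∈ A ∖ {a} as a parent (b → a), else 0.
cBool : {n : ℕ} → Digraph n → Subset n → Bool
cBool {n} D A =
  any (λ a → lookup A a ∧
        all (λ b → not (lookup A b) ∨ ⌊ b ≟ a ⌋ ∨ D b a) (elems n))
      (elems n)

b2q : Bool → ℚ
b2q true  = 1ℚ
b2q false = 0ℚ

Point : ℕ → Set
Point n = Subset n → ℚ

cim : {n : ℕ} → Digraph n → Point n
cim D A = b2q (cBool D A)

PSet : ℕ → Set₁
PSet n = Point n → Set

wsum : {n : ℕ} → List (ℚ × Point n) → Subset n → ℚ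
wsum []             A = 0ℚ
wsum ((q , v) ∷ xs) A = q * v A + wsum xs A

weights : {n : ℕ} → List (ℚ × Point n) → ℚ
weights []             = 0ℚ
weights ((q , _) ∷ xs) = q + weights xs

conv : {n : ℕ} → PSet n → PSet n
conv {n} S x = Σ (List (ℚ × Point n)) λ xs →
    All (λ qv → (0ℚ ≤ Data.Product.proj₁ qv) × S (Data.Product.proj₂ qv)) xs
  × (weights xs ≡ 1ℚ)
  × (∀ A → x A ≡ wsum xs A)

dot : {n : ℕ} → Point n → Point n → ℚ
dot {n} w x = foldr (λ A s → w A * x A + s) 0ℚ (allSubsets n)

IsFace : {n : ℕ} → PSet n → PSet n → Set
IsFace {n} F P = Σ (Point n) λ w → Σ ℚ λ b →
    (∀ x → P x → dot w x ≤ b)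
  × (∀ x → (F x → P x × (dot w x ≡ b)) × (P x × (dot w x ≡ b) → F x))

vCIMpK : (p K : ℕ) → PSet (p +ℕ K)
vCIMpK p K x = Σ (Digraph p) λ E → Σ (Targets p K) λ J →
  IsDAG E × (∀ A → x A ≡ cim (jDAG E J) A)

vCIMpI : {p K : ℕ} → Targets p K → PSet (p +ℕ K)
vCIMpI {p} I x = Σ (Digraph p) λ E →
  IsDAG E × (∀ A → x A ≡ cim (jDAG E I) A)

vCIMGI : {p K : ℕ} → SimpleGraph p → Targets p K → PSet (p +ℕ K)
vCIMGI {p} G I x = Σ (Digraph p) λ E →
  IsDAG E × HasSkeleton E G × (∀ A → x A ≡ cim (jDAG E I) A)

CIM-pK : (p K : ℕ) → PSet (p +ℕ K)
CIM-pK p K = conv (vCIMpK p K)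

CIM-pI : {p K : ℕ} → Targets p K → PSet (p +ℕ K)
CIM-pI I = conv (vCIMpI I)

CIM-GI : {p K : ℕ} → SimpleGraph p → Targets p K → PSet (p +ℕ K)
CIM-GI G I = conv (vCIMGI G I)

{-# OPTIONS --safe #-}
-- Let H be the digraph on [p] ∪ {z₁,…,z_K} with every edge of G in both directions and z_k → i
-- for i ∈ I_k. For a two-element set A = {u, v}, c_D(A) = 1 exactly when u and v are adjacent
-- in D, so the pair coordinates of a characteristic imset record the skeleton. The weight
-- w_A = +1 on adjacent pairs of H, −1 on non-adjacent pairs and 0 elsewhere satisfies
--   w · c_D = #(adjacent pairs of H) − #(pairs on which D and H disagree),
-- so w · c is at most the number of adjacent pairs of H on every 𝒥-DAG, with equality iff 𝒢^𝒥
-- has the skeleton of H, i.e. iff 𝒢 has skeleton G and 𝒥 = 𝓘. A valid inequality whose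
-- tight vertices are exactly V′ cuts out conv V′ as a face of the polytope.
module Submission where

open import Defs
open import Algebra.Bundles using (CommutativeMonoid)
open import Data.Bool as Bool using (Bool; true; false; T; _∧_; _∨_; not; _xor_; if_then_else_)
open import Data.Bool.Properties using (T-≡; T-∧; T-∨; ∨-identityʳ; ∨-idem)
open import Data.Empty using (⊥-elim)
open import Data.Fin as Fin using (Fin; splitAt; _↑ˡ_; _↑ʳ_)
open import Data.Fin.Properties using (any?; splitAt-↑ˡ; splitAt-↑ʳ; splitAt⁻¹-↑ˡ; splitAt⁻¹-↑ʳ; ↑ˡ-injective)
open import Data.Fin.Subset using (Subset; _∈_; ⁅_⁆; _∪_)
open import Data.Fin.Subset.Properties using (x∈⁅x⁆; x∈⁅y⁆⇒x≡y; x∈p∪q⁻; x∈p∪q⁺)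
open import Data.List using (List; []; _∷_; foldr; map)
open import Data.List.Membership.Propositional using (lose) renaming (_∈_ to _∈ˡ_)
open import Data.List.Membership.Propositional.Properties using (∈-++⁺ˡ; ∈-++⁺ʳ; ∈-map⁺; ∈-allFin)
open import Data.List.Relation.Unary.All as All using (All; []; _∷_)
open import Data.List.Relation.Unary.All.Properties using (all⁺; all⁻)
open import Data.List.Relation.Unary.Any using (here; there; satisfied)
open import Data.List.Relation.Unary.Any.Properties using (any⁺; any⁻)
open import Data.Nat using (ℕ; suc) renaming (_+_ to _+ℕ_)
open import Data.Product using (Σ; ∃; ∃₂; _×_; _,_; proj₁; proj₂; map₁; map₂; uncurry)
open import Data.Rational using (ℚ; 0ℚ; 1ℚ; _+_; -_; _*_; _≤_; 1/_; NonZero; nonNegative; ≢-nonZero)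
open import Data.Rational.Properties
open import Data.Rational.Solver using (module +-*-Solver)
open import Data.Sum as Sum using (_⊎_; inj₁; inj₂)
open import Data.Unit using (tt)
open import Data.Vec using ([]; _∷_; lookup)
open import Data.Vec.Properties using ([]=⇒lookup; lookup⇒[]=; ≡-dec)
open import Function using (_∘_; _⇔_; mk⇔; Equivalence; case_of_)
import Function.Properties.Equivalence as ⇔
open import Relation.Binary.Definitions using (tri<; tri≈; tri>)
open import Relation.Binary.PropositionalEquality
open import Relation.Nullary using (Dec; yes; no; ¬?; _×-dec_)
open import Relation.Nullary.Decidable using (⌊_⌋; toWitness; fromWitness)

open import Algebra.Properties.Group +-0-group using (∙-cancelˡ)
open import Algebra.Properties.CommutativeSemigroup
  (CommutativeMonoid.commutativeSemigroup +-0-commutativeMonoid) using (interchange)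
open +-*-Solver using (solve; _:=_; _:+_; _:*_)

+-mono-≤-≡⇒≡ : ∀ {a c x y : ℚ} → a ≤ c → x ≤ y → a + x ≡ c + y → a ≡ c × x ≡ y
+-mono-≤-≡⇒≡ {a} {c} a≤c x≤y eq with <-cmp a c
... | tri< a<c _ _ = ⊥-elim (<-irrefl eq (+-mono-<-≤ a<c x≤y))
... | tri> _ _ c<a = ⊥-elim (<-irrefl refl (<-≤-trans c<a a≤c))
... | tri≈ _ refl _ = refl , ∙-cancelˡ a _ _ eq

*-cancelˡ-≡ : ∀ q .{{_ : NonZero q}} {x y : ℚ} → q * x ≡ q * y → x ≡ y
*-cancelˡ-≡ q {x} {y} eq = begin
  x                ≡⟨ sym (*-identityˡ x) ⟩
  1ℚ * x           ≡⟨ cong (_* x) (sym (*-inverseˡ q)) ⟩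
  (1/ q) * q * x   ≡⟨ *-assoc (1/ q) q x ⟩
  (1/ q) * (q * x) ≡⟨ cong ((1/ q) *_) eq ⟩
  (1/ q) * (q * y) ≡⟨ sym (*-assoc (1/ q) q y) ⟩
  (1/ q) * q * y   ≡⟨ cong (_* y) (*-inverseˡ q) ⟩
  1ℚ * y           ≡⟨ *-identityˡ y ⟩
  y                ∎
  where open ≡-Reasoning

module _ {A : Set} where

  ∑ : (A → ℚ) → List A → ℚ
  ∑ f = foldr (λ a s → f a + s) 0ℚ

  ∑-cong : ∀ {f g : A → ℚ} → (∀ a → f a ≡ g a) → ∀ xs → ∑ f xs ≡ ∑ g xs
  ∑-cong f≐g []       = refl
  ∑-cong f≐g (a ∷ xs) = cong₂ _+_ (f≐g a) (∑-cong f≐g xs)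

  ∑-zero : ∀ {f : A → ℚ} → (∀ a → f a ≡ 0ℚ) → ∀ xs → ∑ f xs ≡ 0ℚ
  ∑-zero f≐0 []       = refl
  ∑-zero f≐0 (a ∷ xs) = trans (cong₂ _+_ (f≐0 a) (∑-zero f≐0 xs)) (+-identityˡ 0ℚ)

  ∑-+ : ∀ (f g : A → ℚ) xs → ∑ (λ a → f a + g a) xs ≡ ∑ f xs + ∑ g xs
  ∑-+ f g []       = sym (+-identityˡ 0ℚ)
  ∑-+ f g (a ∷ xs) = trans (cong (f a + g a +_) (∑-+ f g xs))
                           (interchange (f a) (g a) (∑ f xs) (∑ g xs))

  ∑-*ˡ : ∀ q (f : A → ℚ) xs → ∑ (λ a → q * f a) xs ≡ q * ∑ f xs
  ∑-*ˡ q f []       = sym (*-zeroʳ q)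
  ∑-*ˡ q f (a ∷ xs) = trans (cong (q * f a +_) (∑-*ˡ q f xs)) (sym (*-distribˡ-+ q (f a) (∑ f xs)))

  ∑-nonNeg : ∀ {f : A → ℚ} → (∀ a → 0ℚ ≤ f a) → ∀ xs → 0ℚ ≤ ∑ f xs
  ∑-nonNeg f≥0 []       = ≤-refl
  ∑-nonNeg f≥0 (a ∷ xs) = +-mono-≤ (f≥0 a) (∑-nonNeg f≥0 xs)

  ∑-nonNeg-≡0 : ∀ {f : A → ℚ} → (∀ a → 0ℚ ≤ f a) → ∀ xs → ∑ f xs ≡ 0ℚ →
                ∀ {a} → a ∈ˡ xs → f a ≡ 0ℚ
  ∑-nonNeg-≡0 f≥0 (b ∷ xs) eq a∈xs
    with +-mono-≤-≡⇒≡ (f≥0 b) (∑-nonNeg f≥0 xs) (trans (+-identityˡ 0ℚ) (sym eq))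
  ∑-nonNeg-≡0 f≥0 (b ∷ xs) eq (here refl) | fb≡0 , _ = sym fb≡0
  ∑-nonNeg-≡0 f≥0 (b ∷ xs) eq (there a∈xs) | _ , rest≡0 = ∑-nonNeg-≡0 f≥0 xs (sym rest≡0) a∈xs

weightedSum : ∀ {n} → (Point n → ℚ) → List (ℚ × Point n) → ℚ
weightedSum f = ∑ (λ qv → proj₁ qv * f (proj₂ qv))

module _ {n : ℕ} (w : Point n) where

  dot-cong : ∀ {x y : Point n} → (∀ A → x A ≡ y A) → dot w x ≡ dot w y
  dot-cong x≐y = ∑-cong (λ A → cong (w A *_) (x≐y A)) (allSubsets n)

  dot-wsum : ∀ xs → dot w (wsum xs) ≡ weightedSum (dot w) xs
  dot-wsum []             = ∑-zero (λ A → *-zeroʳ (w A)) (allSubsets n)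
  dot-wsum ((q , v) ∷ xs) = begin
    dot w (λ A → q * v A + wsum xs A)
      ≡⟨ ∑-cong (λ A → solve 4 (λ w q v s → w :* (q :* v :+ s) := q :* (w :* v) :+ w :* s)
                                refl (w A) q (v A) (wsum xs A)) (allSubsets n) ⟩
    ∑ (λ A → q * (w A * v A) + w A * wsum xs A) (allSubsets n)
      ≡⟨ ∑-+ (λ A → q * (w A * v A)) (λ A → w A * wsum xs A) (allSubsets n) ⟩
    ∑ (λ A → q * (w A * v A)) (allSubsets n) + dot w (wsum xs)
      ≡⟨ cong₂ _+_ (∑-*ˡ q _ (allSubsets n)) (dot-wsum xs) ⟩
    q * dot w v + weightedSum (dot w) xs ∎
    where open ≡-Reasoning

-- Faces cut out by a valid inequality

Combination : {n : ℕ} → PSet n → List (ℚ × Point n) → Set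
Combination S = All (λ qv → (0ℚ ≤ proj₁ qv) × S (proj₂ qv))

module _ {n : ℕ} {S : PSet n} (f : Point n → ℚ) (b : ℚ) where

  combination-≤ : (∀ v → S v → f v ≤ b) → ∀ {xs} → Combination S xs → weightedSum f xs ≤ weights xs * b
  combination-≤ f≤b {[]}           []                = ≤-reflexive (sym (*-zeroˡ b))
  combination-≤ f≤b {(q , v) ∷ xs} ((q≥0 , sv) ∷ cs) = begin
    q * f v + weightedSum f xs ≤⟨ +-mono-≤ (*-monoˡ-≤-nonNeg q {{nonNegative q≥0}} (f≤b v sv))
                                           (combination-≤ f≤b cs) ⟩
    q * b + weights xs * b     ≡⟨ *-distribʳ-+ b q (weights xs) ⟨
    (q + weights xs) * b       ∎
    where open ≤-Reasoning

  combination-≡ : (∀ v → S v → f v ≡ b) → ∀ {xs} → Combination S xs → weightedSum f xs ≡ weights xs * b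
  combination-≡ f≡b {[]}           []                = sym (*-zeroˡ b)
  combination-≡ f≡b {(q , v) ∷ xs} ((_ , sv) ∷ cs) =
    trans (cong₂ (λ t s → q * t + s) (f≡b v sv) (combination-≡ f≡b cs))
          (sym (*-distribʳ-+ b q (weights xs)))

  combination-≡⁻ : (∀ v → S v → f v ≤ b) → ∀ {xs} → Combination S xs → weightedSum f xs ≡ weights xs * b →
                   All (λ qv → proj₁ qv ≡ 0ℚ ⊎ f (proj₂ qv) ≡ b) xs
  combination-≡⁻ f≤b {[]}           []                _  = []
  combination-≡⁻ f≤b {(q , v) ∷ xs} ((q≥0 , sv) ∷ cs) eq
    with +-mono-≤-≡⇒≡ (*-monoˡ-≤-nonNeg q {{nonNegative q≥0}} (f≤b v sv)) (combination-≤ f≤b cs)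
                      (trans eq (*-distribʳ-+ b q (weights xs)))
  ... | head≡ , rest≡ = null-or-tight ∷ combination-≡⁻ f≤b cs rest≡
    where
    null-or-tight : q ≡ 0ℚ ⊎ f v ≡ b
    null-or-tight with q ≟ 0ℚ
    ... | yes q≡0 = inj₁ q≡0
    ... | no  q≢0 = inj₂ (*-cancelˡ-≡ q {{≢-nonZero q≢0}} head≡)

conv-mono : ∀ {n} {S T : PSet n} → (∀ v → S v → T v) → ∀ x → conv S x → conv T x
conv-mono S⊆T x (xs , cs , w≡1 , x≐xs) = xs , All.map (map₂ (S⊆T _)) cs , w≡1 , x≐xs

combination-prune : ∀ {n} {S P : PSet n} {xs} → Combination S xs →
                    All (λ qv → proj₁ qv ≡ 0ℚ ⊎ P (proj₂ qv)) xs →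
                    Σ (List (ℚ × Point n)) λ ys → Combination (λ v → S v × P v) ys
                      × weights ys ≡ weights xs × (∀ A → wsum ys A ≡ wsum xs A)
combination-prune {xs = []} [] [] = [] , [] , refl , λ _ → refl
combination-prune {xs = (q , v) ∷ xs} (_ ∷ cs) (inj₁ refl ∷ ps) with combination-prune cs ps
... | ys , ds , ys≐xs , wsum≐ = ys , ds , trans ys≐xs (sym (+-identityˡ (weights xs))) ,
      λ A → trans (wsum≐ A) (sym (trans (cong (_+ wsum xs A) (*-zeroˡ (v A))) (+-identityˡ (wsum xs A))))
combination-prune {xs = (q , v) ∷ xs} ((q≥0 , sv) ∷ cs) (inj₂ pv ∷ ps) with combination-prune cs ps
... | ys , ds , ys≐xs , wsum≐ = (q , v) ∷ ys , (q≥0 , sv , pv) ∷ ds , cong (q +_) ys≐xs ,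
      λ A → cong (q * v A +_) (wsum≐ A)

conv-face : ∀ {n} {S T : PSet n} (w : Point n) (b : ℚ) →
            (∀ v → S v → dot w v ≤ b) →
            (∀ v → S v → dot w v ≡ b → T v) →
            (∀ v → T v → S v × dot w v ≡ b) →
            IsFace (conv T) (conv S)
conv-face {n} {S} {T} w b valid tight⇒T T⇒tight = w , b , conv-valid , λ x → conv-T⇒tight x , tight⇒conv-T x
  where
  dot-combination : ∀ {x} xs → (∀ A → x A ≡ wsum xs A) → dot w x ≡ weightedSum (dot w) xs
  dot-combination xs x≐xs = trans (dot-cong w x≐xs) (dot-wsum w xs)

  unit-mass : ∀ {m} → m ≡ 1ℚ → m * b ≡ b
  unit-mass w≡1 = trans (cong (_* b) w≡1) (*-identityˡ b)

  conv-valid : ∀ x → conv S x → dot w x ≤ b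
  conv-valid x (xs , cs , w≡1 , x≐xs) = begin
    dot w x                ≡⟨ dot-combination xs x≐xs ⟩
    weightedSum (dot w) xs ≤⟨ combination-≤ (dot w) b valid cs ⟩
    weights xs * b         ≡⟨ unit-mass w≡1 ⟩
    b                      ∎
    where open ≤-Reasoning

  conv-T⇒tight : ∀ x → conv T x → conv S x × dot w x ≡ b
  conv-T⇒tight x t@(xs , cs , w≡1 , x≐xs) =
    conv-mono (λ v → proj₁ ∘ T⇒tight v) x t ,
    trans (dot-combination xs x≐xs)
          (trans (combination-≡ (dot w) b (λ v → proj₂ ∘ T⇒tight v) cs) (unit-mass w≡1))

  tight⇒conv-T : ∀ x → conv S x × dot w x ≡ b → conv T x
  tight⇒conv-T x ((xs , cs , w≡1 , x≐xs) , dot≡b)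
    with combination-prune cs (combination-≡⁻ (dot w) b valid cs
           (trans (sym (dot-combination xs x≐xs)) (trans dot≡b (sym (unit-mass w≡1)))))
  ... | ys , ds , ys≐xs , wsum≐ =
    conv-mono (λ v (sv , tight) → tight⇒T v sv tight) x
      (ys , ds , trans ys≐xs w≡1 , λ A → trans (x≐xs A) (sym (wsum≐ A)))

-- Distance of a 0/1 point to a fixed pattern

∈-allSubsets : ∀ {n} (A : Subset n) → A ∈ˡ allSubsets n
∈-allSubsets []                  = here refl
∈-allSubsets         (true ∷ A)  = ∈-++⁺ˡ (∈-map⁺ (true ∷_) (∈-allSubsets A))
∈-allSubsets {suc n} (false ∷ A) = ∈-++⁺ʳ (map (true ∷_) (allSubsets n)) (∈-map⁺ (false ∷_) (∈-allSubsets A))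

b2q-nonNeg : ∀ x → 0ℚ ≤ b2q x
b2q-nonNeg false = ≤-refl
b2q-nonNeg true  = ≤ᵇ⇒≤ _

b2q≡0⇒false : ∀ {x} → b2q x ≡ 0ℚ → x ≡ false
b2q≡0⇒false {false} _ = refl

agreementCoefficient : Bool → Bool → ℚ
agreementCoefficient s h = if s then (if h then 1ℚ else - 1ℚ) else 0ℚ

module _ {n : ℕ} (s h : Subset n → Bool) where

  agreementWeight : Point n
  agreementWeight A = agreementCoefficient (s A) (h A)

  agreementBound : ℚ
  agreementBound = ∑ (λ A → b2q (s A ∧ h A)) (allSubsets n)

  mismatches : (Subset n → Bool) → ℚ
  mismatches c = ∑ (λ A → b2q (s A ∧ (h A xor c A))) (allSubsets n)

  private
    coordinate : ∀ s h c → agreementCoefficient s h * b2q c + b2q (s ∧ (h xor c)) ≡ b2q (s ∧ h)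
    coordinate false false false = refl
    coordinate false false true  = refl
    coordinate false true  false = refl
    coordinate false true  true  = refl
    coordinate true  false false = refl
    coordinate true  false true  = refl
    coordinate true  true  false = refl
    coordinate true  true  true  = refl

    mismatch-free : ∀ s h c → s ∧ (h xor c) ≡ false → T s → c ≡ h
    mismatch-free true false false _ _ = refl
    mismatch-free true true  true  _ _ = refl

    mismatch-free⁻ : ∀ s h c → (T s → c ≡ h) → s ∧ (h xor c) ≡ false
    mismatch-free⁻ false _     _     _   = refl
    mismatch-free⁻ true  false false _   = refl
    mismatch-free⁻ true  true  true  _   = refl
    mismatch-free⁻ true  false true  c≡h with () ← c≡h tt
    mismatch-free⁻ true  true  false c≡h with () ← c≡h tt

  agreement-identity : ∀ c → dot agreementWeight (b2q ∘ c) + mismatches c ≡ agreementBound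
  agreement-identity c = trans (sym (∑-+ (λ A → agreementWeight A * b2q (c A))
                                          (λ A → b2q (s A ∧ (h A xor c A))) (allSubsets n)))
                               (∑-cong (λ A → coordinate (s A) (h A) (c A)) (allSubsets n))

  agreement-≤ : ∀ c → dot agreementWeight (b2q ∘ c) ≤ agreementBound
  agreement-≤ c = begin
    d                ≡⟨ +-identityʳ d ⟨
    d + 0ℚ           ≤⟨ +-monoʳ-≤ d (∑-nonNeg (λ A → b2q-nonNeg (s A ∧ (h A xor c A))) (allSubsets n)) ⟩
    d + mismatches c ≡⟨ agreement-identity c ⟩
    agreementBound   ∎
    where open ≤-Reasoning
          d = dot agreementWeight (b2q ∘ c)

  agreement-≡⇔ : ∀ c → dot agreementWeight (b2q ∘ c) ≡ agreementBound ⇔ (∀ A → T (s A) → c A ≡ h A)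
  agreement-≡⇔ c = mk⇔ tight⇒agree agree⇒tight
    where
    d = dot agreementWeight (b2q ∘ c)

    tight⇒agree : d ≡ agreementBound → ∀ A → T (s A) → c A ≡ h A
    tight⇒agree tight A = mismatch-free (s A) (h A) (c A) (b2q≡0⇒false
      (∑-nonNeg-≡0 (λ A → b2q-nonNeg (s A ∧ (h A xor c A))) (allSubsets n)
        (∙-cancelˡ d (mismatches c) 0ℚ (trans (agreement-identity c) (trans (sym tight) (sym (+-identityʳ d)))))
        (∈-allSubsets A)))

    agree⇒tight : (∀ A → T (s A) → c A ≡ h A) → d ≡ agreementBound
    agree⇒tight agree = begin
      d                ≡⟨ +-identityʳ d ⟨
      d + 0ℚ           ≡⟨ cong (d +_) no-mismatches ⟨
      d + mismatches c ≡⟨ agreement-identity c ⟩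
      agreementBound   ∎
      where open ≡-Reasoning
            no-mismatches : mismatches c ≡ 0ℚ
            no-mismatches = ∑-zero (λ A → cong b2q (mismatch-free⁻ (s A) (h A) (c A) (agree A))) (allSubsets n)

-- Characteristic imsets on two-element sets

T-⇔⇒≡ : ∀ {x y} → T x ⇔ T y → x ≡ y
T-⇔⇒≡ {false} {false} _   = refl
T-⇔⇒≡ {false} {true}  x⇔y = ⊥-elim (Equivalence.from x⇔y tt)
T-⇔⇒≡ {true}  {false} x⇔y = ⊥-elim (Equivalence.to x⇔y tt)
T-⇔⇒≡ {true}  {true}  _   = refl

∈⇔T-lookup : ∀ {n} {a : Fin n} {A : Subset n} → a ∈ A ⇔ T (lookup A a)
∈⇔T-lookup {a = a} {A} = mk⇔ (Equivalence.from T-≡ ∘ []=⇒lookup) (lookup⇒[]= a A ∘ Equivalence.to T-≡)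

HasSink : ∀ {n} → Digraph n → Subset n → Set
HasSink D A = ∃ λ a → a ∈ A × (∀ {b} → b ∈ A → b ≢ a → T (D b a))

module _ {n : ℕ} (D : Digraph n) (A : Subset n) where

  private
    parentsOf : Fin n → Fin n → Bool
    parentsOf a b = not (lookup A b) ∨ ⌊ b Fin.≟ a ⌋ ∨ D b a

    parentsOf⁺ : ∀ {a b} → (b ∈ A → b ≢ a → T (D b a)) → T (parentsOf a b)
    parentsOf⁺ {a} {b} par with lookup A b in b∈A | b Fin.≟ a
    ... | false | _       = tt
    ... | true  | yes _   = tt
    ... | true  | no  b≢a = par (lookup⇒[]= b A b∈A) b≢a

    parentsOf⁻ : ∀ {a b} → T (parentsOf a b) → b ∈ A → b ≢ a → T (D b a)
    parentsOf⁻ {a} {b} t b∈A b≢a with lookup A b | Equivalence.to ∈⇔T-lookup b∈A | b Fin.≟ a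
    ... | true | _ | yes b≡a = ⊥-elim (b≢a b≡a)
    ... | true | _ | no  _   = t

  cBool⇔ : T (cBool D A) ⇔ HasSink D A
  cBool⇔ = mk⇔ sink sink⁻¹
    where
    sink : T (cBool D A) → HasSink D A
    sink t with satisfied (any⁻ _ (elems n) t)
    ... | a , t′ with Equivalence.to (T-∧ {lookup A a}) t′
    ... | a∈A , par = a , Equivalence.from ∈⇔T-lookup a∈A ,
                      λ {b} → parentsOf⁻ (All.lookup (all⁺ (parentsOf a) (elems n) par) (∈-allFin b))

    sink⁻¹ : HasSink D A → T (cBool D A)
    sink⁻¹ (a , a∈A , par) = any⁺ _ (lose (∈-allFin a)
      (Equivalence.from T-∧ (Equivalence.to ∈⇔T-lookup a∈A ,
                             all⁻ (parentsOf a) (All.universal (λ _ → parentsOf⁺ par) (elems n)))))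

cBool-mono : ∀ {n} {D D′ : Digraph n} → (∀ {u v} → T (D u v) → T (D′ u v)) →
             ∀ A → T (cBool D A) → T (cBool D′ A)
cBool-mono {D = D} {D′} D⊆D′ A t with Equivalence.to (cBool⇔ D A) t
... | a , a∈A , par = Equivalence.from (cBool⇔ D′ A) (a , a∈A , λ b∈A b≢a → D⊆D′ (par b∈A b≢a))

cBool-cong : ∀ {n} {D D′ : Digraph n} → (∀ u v → D u v ≡ D′ u v) → ∀ A → cBool D A ≡ cBool D′ A
cBool-cong D≐D′ A = T-⇔⇒≡ (mk⇔ (cBool-mono (subst T (D≐D′ _ _)) A)
                              (cBool-mono (subst T (sym (D≐D′ _ _))) A))

module _ {n : ℕ} {u v : Fin n} where

  pair-member : ∀ {b} → b ∈ ⁅ u ⁆ ∪ ⁅ v ⁆ → b ≡ u ⊎ b ≡ v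
  pair-member = Sum.map (x∈⁅y⁆⇒x≡y u) (x∈⁅y⁆⇒x≡y v) ∘ x∈p∪q⁻ ⁅ u ⁆ ⁅ v ⁆

  u∈pair : u ∈ ⁅ u ⁆ ∪ ⁅ v ⁆
  u∈pair = x∈p∪q⁺ (inj₁ (x∈⁅x⁆ u))

  v∈pair : v ∈ ⁅ u ⁆ ∪ ⁅ v ⁆
  v∈pair = x∈p∪q⁺ (inj₂ (x∈⁅x⁆ v))

  cBool-pair : (D : Digraph n) → u ≢ v → cBool D (⁅ u ⁆ ∪ ⁅ v ⁆) ≡ D u v ∨ D v u
  cBool-pair D u≢v = T-⇔⇒≡ (⇔.trans (cBool⇔ D (⁅ u ⁆ ∪ ⁅ v ⁆)) (mk⇔ sink⇒edge edge⇒sink))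
    where
    sink⇒edge : HasSink D (⁅ u ⁆ ∪ ⁅ v ⁆) → T (D u v ∨ D v u)
    sink⇒edge (a , a∈ , par) with pair-member a∈
    ... | inj₁ refl = Equivalence.from T-∨ (inj₂ (par v∈pair (u≢v ∘ sym)))
    ... | inj₂ refl = Equivalence.from T-∨ (inj₁ (par u∈pair u≢v))

    edge⇒sink : T (D u v ∨ D v u) → HasSink D (⁅ u ⁆ ∪ ⁅ v ⁆)
    edge⇒sink t with Equivalence.to T-∨ t
    ... | inj₁ uv = v , v∈pair , λ b∈ b≢v → case pair-member b∈ of λ where
                      (inj₁ refl) → uv
                      (inj₂ b≡v)  → ⊥-elim (b≢v b≡v)
    ... | inj₂ vu = u , u∈pair , λ b∈ b≢u → case pair-member b∈ of λ where
                      (inj₁ b≡u)  → ⊥-elim (b≢u b≡u)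
                      (inj₂ refl) → vu

SameSkeleton : ∀ {n} → Digraph n → Digraph n → Set
SameSkeleton {n} D D′ = ∀ (u v : Fin n) → u ≢ v → D u v ∨ D v u ≡ D′ u v ∨ D′ v u

IsPair : ∀ {n} → Subset n → Set
IsPair {n} A = ∃₂ λ (u v : Fin n) → u ≢ v × A ≡ ⁅ u ⁆ ∪ ⁅ v ⁆

isPair? : ∀ {n} (A : Subset n) → Dec (IsPair A)
isPair? A = any? λ u → any? λ v → ¬? (u Fin.≟ v) ×-dec ≡-dec Bool._≟_ A (⁅ u ⁆ ∪ ⁅ v ⁆)

sameSkeleton⇔cBool-pairs : ∀ {n} {D D′ : Digraph n} →
                           SameSkeleton D D′ ⇔ (∀ A → IsPair A → cBool D A ≡ cBool D′ A)
sameSkeleton⇔cBool-pairs {D = D} {D′} = mk⇔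
  (λ { skel A (u , v , u≢v , refl) →
         trans (cBool-pair D u≢v) (trans (skel u v u≢v) (sym (cBool-pair D′ u≢v))) })
  (λ pairs u v u≢v →
         trans (sym (cBool-pair D u≢v)) (trans (pairs _ (u , v , u≢v , refl)) (cBool-pair D′ u≢v)))

-- Skeletons of 𝒥-DAGs

data SplitView (p K : ℕ) : Fin (p +ℕ K) → Set where
  node   : (i : Fin p) → SplitView p K (i ↑ˡ K)
  target : (k : Fin K) → SplitView p K (p ↑ʳ k)

splitView : ∀ p K (u : Fin (p +ℕ K)) → SplitView p K u
splitView p K u with splitAt p u in eq
... | inj₁ i = subst (SplitView p K) (splitAt⁻¹-↑ˡ eq) (node i)
... | inj₂ k = subst (SplitView p K) (splitAt⁻¹-↑ʳ eq) (target k)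

↑ʳ≢↑ˡ : ∀ {p K} (k : Fin K) (i : Fin p) → p ↑ʳ k ≢ i ↑ˡ K
↑ʳ≢↑ˡ {p} {K} k i eq with trans (sym (splitAt-↑ʳ p K k)) (trans (cong (splitAt p) eq) (splitAt-↑ˡ p i K))
... | ()

SameTargets : ∀ {p K} → Targets p K → Targets p K → Set
SameTargets J J′ = ∀ k i → lookup (J k) i ≡ lookup (J′ k) i

module _ {p K : ℕ} (E : Digraph p) (J : Targets p K) where

  jDAG-node-node : ∀ i j → jDAG E J (i ↑ˡ K) (j ↑ˡ K) ≡ E i j
  jDAG-node-node i j rewrite splitAt-↑ˡ p i K | splitAt-↑ˡ p j K = refl

  jDAG-target-node : ∀ k i → jDAG E J (p ↑ʳ k) (i ↑ˡ K) ≡ lookup (J k) i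
  jDAG-target-node k i rewrite splitAt-↑ʳ p K k | splitAt-↑ˡ p i K = refl

  jDAG-node-target : ∀ i k → jDAG E J (i ↑ˡ K) (p ↑ʳ k) ≡ false
  jDAG-node-target i k rewrite splitAt-↑ˡ p i K | splitAt-↑ʳ p K k = refl

  jDAG-target-target : ∀ k l → jDAG E J (p ↑ʳ k) (p ↑ʳ l) ≡ false
  jDAG-target-target k l rewrite splitAt-↑ʳ p K k | splitAt-↑ʳ p K l = refl

jDAG-cong : ∀ {p K} (E : Digraph p) {J J′ : Targets p K} → SameTargets J J′ →
            ∀ u v → jDAG E J u v ≡ jDAG E J′ u v
jDAG-cong {p} E J≐J′ u v with splitAt p u | splitAt p v
... | inj₁ _ | inj₁ _ = refl
... | inj₁ _ | inj₂ _ = refl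
... | inj₂ k | inj₁ i = J≐J′ k i
... | inj₂ _ | inj₂ _ = refl

module _ {p K : ℕ} {E E′ : Digraph p} {J J′ : Targets p K} where

  jDAG-sameSkeleton⁺ : SameSkeleton E E′ → SameTargets J J′ → SameSkeleton (jDAG E J) (jDAG E′ J′)
  jDAG-sameSkeleton⁺ skel J≐J′ u v u≢v with splitView p K u | splitView p K v
  ... | node i | node j
    rewrite jDAG-node-node E J i j | jDAG-node-node E J j i
          | jDAG-node-node E′ J′ i j | jDAG-node-node E′ J′ j i = skel i j (u≢v ∘ cong (_↑ˡ K))
  ... | node i | target k
    rewrite jDAG-node-target E J i k | jDAG-target-node E J k i
          | jDAG-node-target E′ J′ i k | jDAG-target-node E′ J′ k i = J≐J′ k i
  ... | target k | node i
    rewrite jDAG-node-target E J i k | jDAG-target-node E J k i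
          | jDAG-node-target E′ J′ i k | jDAG-target-node E′ J′ k i = cong (_∨ false) (J≐J′ k i)
  ... | target k | target l
    rewrite jDAG-target-target E J k l | jDAG-target-target E J l k
          | jDAG-target-target E′ J′ k l | jDAG-target-target E′ J′ l k = refl

  jDAG-sameSkeleton⁻ : SameSkeleton (jDAG E J) (jDAG E′ J′) → SameSkeleton E E′ × SameTargets J J′
  jDAG-sameSkeleton⁻ skel = nodes , targets
    where
    nodes : SameSkeleton E E′
    nodes i j i≢j with skel (i ↑ˡ K) (j ↑ˡ K) (i≢j ∘ ↑ˡ-injective K i j)
    ... | eq rewrite jDAG-node-node E J i j | jDAG-node-node E J j i
                   | jDAG-node-node E′ J′ i j | jDAG-node-node E′ J′ j i = eq

    targets : SameTargets J J′
    targets k i with skel (p ↑ʳ k) (i ↑ˡ K) (↑ʳ≢↑ˡ k i)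
    ... | eq rewrite jDAG-target-node E J k i | jDAG-node-target E J i k
                   | jDAG-target-node E′ J′ k i | jDAG-node-target E′ J′ i k =
      trans (sym (∨-identityʳ _)) (trans eq (∨-identityʳ _))

IsDAG⇒irreflexive : ∀ {n} {E : Digraph n} → IsDAG E → ∀ i → E i i ≡ false
IsDAG⇒irreflexive {E = E} dag i with E i i in eq
... | false = refl
... | true  = ⊥-elim (dag i (edge eq))

module _ {p : ℕ} (G : SimpleGraph p) where

  open SimpleGraph G using (adj; irrefl) renaming (sym to adj-sym)

  adj-∨-sym : ∀ i j → adj i j ∨ adj j i ≡ adj i j
  adj-∨-sym i j = trans (cong (adj i j ∨_) (adj-sym j i)) (∨-idem (adj i j))

  hasSkeleton⇔sameSkeleton : ∀ {E : Digraph p} → (∀ i → E i i ≡ false) →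
                             HasSkeleton E G ⇔ SameSkeleton E adj
  hasSkeleton⇔sameSkeleton {E} E-irrefl = mk⇔
    (λ skel i j _ → trans (skel i j) (sym (adj-∨-sym i j)))
    (λ skel i j → case i Fin.≟ j of λ where
       (yes refl) → trans (cong₂ _∨_ (E-irrefl i) (E-irrefl i)) (sym (irrefl i))
       (no  i≢j)  → trans (skel i j i≢j) (adj-∨-sym i j))

module SkeletonFace {p K : ℕ} (G : SimpleGraph p) (I : Targets p K) where

  H : Digraph (p +ℕ K)
  H = jDAG (SimpleGraph.adj G) I

  isPair : Subset (p +ℕ K) → Bool
  isPair A = ⌊ isPair? A ⌋

  weight : Point (p +ℕ K)
  weight = agreementWeight isPair (cBool H)

  bound : ℚ
  bound = agreementBound isPair (cBool H)

  tight⇔sameSkeleton : ∀ D → dot weight (cim D) ≡ bound ⇔ SameSkeleton D H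
  tight⇔sameSkeleton D = ⇔.trans (agreement-≡⇔ isPair (cBool H) (cBool D))
    (⇔.trans (mk⇔ (λ agree A → agree A ∘ fromWitness) (λ agree A → agree A ∘ toWitness))
             (⇔.sym sameSkeleton⇔cBool-pairs))

  jDAG-tight⇔ : ∀ {E J} → IsDAG E →
                dot weight (cim (jDAG E J)) ≡ bound ⇔ (HasSkeleton E G × SameTargets J I)
  jDAG-tight⇔ {E} {J} dag = ⇔.trans (tight⇔sameSkeleton (jDAG E J))
    (mk⇔ (map₁ (Equivalence.from skeleton⇔) ∘ jDAG-sameSkeleton⁻)
         (uncurry jDAG-sameSkeleton⁺ ∘ map₁ (Equivalence.to skeleton⇔)))
    where skeleton⇔ = hasSkeleton⇔sameSkeleton G {E} (IsDAG⇒irreflexive dag)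

  vertex-≤ : ∀ {x} D → (∀ A → x A ≡ cim D A) → dot weight x ≤ bound
  vertex-≤ D x≐D = ≤-trans (≤-reflexive (dot-cong weight x≐D)) (agreement-≤ isPair (cBool H) (cBool D))

  tight-vertex⇒vCIMGI : ∀ {x} E J → IsDAG E → (∀ A → x A ≡ cim (jDAG E J) A) →
                        dot weight x ≡ bound → vCIMGI G I x
  tight-vertex⇒vCIMGI E J dag x≐ tight
    with Equivalence.to (jDAG-tight⇔ dag) (trans (sym (dot-cong weight x≐)) tight)
  ... | skel , J≐I = E , dag , skel , λ A → trans (x≐ A) (cong b2q (cBool-cong (jDAG-cong E J≐I) A))

  vCIMGI⇒tight-vertex : ∀ {x} → vCIMGI G I x → vCIMpI I x × dot weight x ≡ bound
  vCIMGI⇒tight-vertex (E , dag , skel , x≐) =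
    (E , dag , x≐) ,
    trans (dot-cong weight x≐) (Equivalence.from (jDAG-tight⇔ dag) (skel , λ _ _ → refl))

proposition3p10 : (p K : ℕ) (G : SimpleGraph p) (I : Targets p K) →
    IsFace (CIM-GI G I) (CIM-pI I) × IsFace (CIM-GI G I) (CIM-pK p K)
proposition3p10 p K G I =
  conv-face weight bound (λ _ (E , _ , x≐) → vertex-≤ (jDAG E I) x≐)
                         (λ _ (E , dag , x≐) → tight-vertex⇒vCIMGI E I dag x≐)
                         (λ _ → vCIMGI⇒tight-vertex) ,
  conv-face weight bound (λ _ (E , J , _ , x≐) → vertex-≤ (jDAG E J) x≐)
                         (λ _ (E , J , dag , x≐) → tight-vertex⇒vCIMGI E J dag x≐)
                         (λ _ → map₁ (λ (E , dag , x≐) → E , I , dag , x≐) ∘ vCIMGI⇒tight-vertex)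
  where open SkeletonFace G I
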